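{- Let $q$ be a prime power and $0<k<n$, $0\le t\le k$ integers. The inclusion map $\iota:\mathcal{P}_t(n,k)\to\mathcal{G}(n,k)$ is a transparent embedding.
   Context: Let $V=\mathbb{F}_q^n$ with its standard basis. An $[n,m]$-linear code is an $m$-dimensional subspace of $V$; $\mathcal{C}_t(n,m)$ denotes the set of $[n,m]$-codes such that any $t$ columns of a generator matrix (an $m\times n$ matrix whose rows form a basis) are linearly independent. The $k$-Grassmann geometry $\mathcal{G}(n,k)$ is the point-line geometry whose points are the $k$-dimensional subspaces of $V$ and whose lines are the sets $\ell_{X,Y}=\{Z:\dim Z=k,\ X\subset Z\subset Y\}$ with $\dim X=k-1$, $\dim Y=k+1$ (if $k<n-1$), respectively $\ell_X=\{Z:\dim Z=n-1,\ X\subset Z\}$ with $\dim X=n-2$ (if $k=n-1$). The geometry $\mathcal{P}_t(n,k)$ has point set $\mathcal{C}_t(n,k)$ and lines $\ell_{X,Y}=\{Z\in\mathcal{C}_t(n,k): X\subset Z\subset Y\}$ with $X\in\mathcal{C}_t(n,k-1)$, $Y\in\mathcal{C}_t(n,k+1)$ (if $k<n-1$), respectively $\ell_X=\{Z\in\mathcal{C}_t(n,n-1):X\subset Z\}$ with $X\in\mathcal{C}_t(n,n-2)$ (if $k=n-1$). An injective map $\varepsilon$ from the points of a point-line geometry $\mathcal{G}_1$ to the points of $\mathcal{G}_2$ is an embedding if the image of every line of $\mathcal{G}_1$ is a line of $\mathcal{G}_2$; it is transparent if moreover the preimage of any line of $\mathcal{G}_2$ contained in the image of $\varepsilon$ is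 a line of $\mathcal{G}_1$. -}

module Defs where

open import Level using (0ℓ)
open import Algebra.Bundles using (CommutativeRing)
open import Data.Nat using (ℕ; zero; suc; _<_; _∸_; _^_)
open import Data.Nat.Primality using (Prime)
open import Data.Fin using (Fin; zero; suc)
open import Data.Product using (Σ; ∃; _×_; _,_; proj₁; proj₂)
open import Relation.Nullary using (¬_)
open import Relation.Binary.PropositionalEquality using (_≡_)
open import Function.Definitions using (Injective)

IsPrimePower : ℕ → Set
IsPrimePower q = Σ ℕ λ p → Σ ℕ λ e → Prime p × q ≡ p ^ suc e

_⇔_ : ∀ {a b} → Set a → Set b → Set _
A ⇔ B = (A → B) × (B → A)

record FiniteField : Set₁ where
  field
    commRing : CommutativeRing 0ℓ 0ℓ
  open CommutativeRing commRing public
  field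
    nontrivial : ¬ (1# ≈ 0#)
    inverse    : ∀ x → ¬ (x ≈ 0#) → Σ Carrier λ y → x * y ≈ 1#
    size       : ℕ
    enum       : Fin size → Carrier
    enum-surj  : ∀ x → Σ (Fin size) λ i → enum i ≈ x
    enum-inj   : ∀ i j → enum i ≈ enum j → i ≡ j

record Geometry : Set₂ where
  field
    Point : Set₁
    _≈ₚ_  : Point → Point → Set₁
    Line  : Set₁
    _on_  : Point → Line → Set₁

module _ (G₁ G₂ : Geometry) where
  private
    module G₁ = Geometry G₁
    module G₂ = Geometry G₂

  record IsEmbedding (ε : G₁.Point → G₂.Point) : Set₂ where
    field
      injective : ∀ p p' → ε p G₂.≈ₚ ε p' → p G₁.≈ₚ p'
      image-line : ∀ (l : G₁.Line) → Σ G₂.Line λ l' →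
        ∀ (x : G₂.Point) →
          (G₂._on_ x l') ⇔ (Σ G₁.Point λ p → G₁._on_ p l × (ε p G₂.≈ₚ x))

  record IsTransparentEmbedding (ε : G₁.Point → G₂.Point) : Set₂ where
    field
      embedding : IsEmbedding ε
      transparent : ∀ (l' : G₂.Line) →
        (∀ (x : G₂.Point) → G₂._on_ x l' → Σ G₁.Point λ p → ε p G₂.≈ₚ x) →
        Σ G₁.Line λ l → ∀ (p : G₁.Point) → (G₁._on_ p l) ⇔ (G₂._on_ (ε p) l')

module Lin (F : FiniteField) where
  open FiniteField F using (Carrier; _≈_; 0#; _+_; _*_)

  Vec : ℕ → Set
  Vec n = Fin n → Carrier

  _≈ᵥ_ : ∀ {n} → Vec n → Vec n → Set
  u ≈ᵥ v = ∀ i → u i ≈ v i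

  0ᵥ : ∀ {n} → Vec n
  0ᵥ _ = 0#

  _+ᵥ_ : ∀ {n} → Vec n → Vec n → Vec n
  (u +ᵥ v) i = u i + v i

  _·ᵥ_ : ∀ {n} → Carrier → Vec n → Vec n
  (a ·ᵥ v) i = a * v i

  sumᵥ : ∀ {n} m → (Fin m → Vec n) → Vec n
  sumᵥ zero    f = 0ᵥ
  sumᵥ (suc m) f = f zero +ᵥ sumᵥ m (λ i → f (suc i))

  lincomb : ∀ {n m} → (Fin m → Carrier) → (Fin m → Vec n) → Vec n
  lincomb {m = m} c vs = sumᵥ m (λ i → c i ·ᵥ vs i)

  LinIndep : ∀ {n m} → (Fin m → Vec n) → Set
  LinIndep {m = m} vs = ∀ (c : Fin m → Carrier) → lincomb c vs ≈ᵥ 0ᵥ → ∀ i → c i ≈ 0#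

  record Subspace (n : ℕ) : Set₁ where
    field
      mem   : Vec n → Set
      resp  : ∀ {u v} → u ≈ᵥ v → mem u → mem v
      mem-0 : mem 0ᵥ
      mem-+ : ∀ {u v} → mem u → mem v → mem (u +ᵥ v)
      mem-· : ∀ a {v} → mem v → mem (a ·ᵥ v)
  open Subspace public

  _⊆_ : ∀ {n} → Subspace n → Subspace n → Set
  X ⊆ Y = ∀ v → mem X v → mem Y v

  _≐_ : ∀ {n} → Subspace n → Subspace n → Set
  X ≐ Y = (X ⊆ Y) × (Y ⊆ X)

  -- the rows vs (an m × n matrix) form a basis of S, i.e. vs is a generator matrix of S
  IsBasis : ∀ {n m} → Subspace n → (Fin m → Vec n) → Set
  IsBasis {n} {m} S vs =
    (∀ i → mem S (vs i)) × LinIndep vs ×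
    (∀ v → mem S v → Σ (Fin m → Carrier) λ c → lincomb c vs ≈ᵥ v)

  HasDim : ∀ {n} → Subspace n → ℕ → Set
  HasDim {n} S m = Σ (Fin m → Vec n) λ vs → IsBasis S vs

  column : ∀ {n m} → (Fin m → Vec n) → Fin n → Vec m
  column vs j i = vs i j

  AnyColsIndep : ∀ {n m} → ℕ → (Fin m → Vec n) → Set
  AnyColsIndep {n} t vs =
    ∀ (js : Fin t → Fin n) → Injective _≡_ _≡_ js → LinIndep (λ a → column vs (js a))

  InC : ∀ {n} → ℕ → ℕ → Subspace n → Set
  InC {n} t m S = Σ (Fin m → Vec n) λ vs → IsBasis S vs × AnyColsIndep t vs

  data GLine (n k : ℕ) : Set₁ where
    lineXY : (X Y : Subspace n) → suc k < n →
             HasDim X (k ∸ 1) → HasDim Y (suc k) → X ⊆ Y → GLine n k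
    lineX  : (X : Subspace n) → suc k ≡ n → HasDim X (n ∸ 2) → GLine n k

  onG : ∀ {n k} → Subspace n → GLine n k → Set
  onG {k = k} Z (lineXY X Y _ _ _ _) = HasDim Z k × X ⊆ Z × Z ⊆ Y
  onG {n = n} Z (lineX X _ _)        = HasDim Z (n ∸ 1) × X ⊆ Z

  Grass : ℕ → ℕ → Geometry
  Grass n k = record
    { Point = Σ (Subspace n) λ Z → HasDim Z k
    ; _≈ₚ_  = λ P Q → Lift1 (proj₁ P ≐ proj₁ Q)
    ; Line  = GLine n k
    ; _on_  = λ P l → Lift1 (onG (proj₁ P) l)
    }
    where
    open import Level using (Lift; lift)
    Lift1 : Set → Set₁
    Lift1 A = Lift _ A

  data PLine (n k t : ℕ) : Set₁ where
    lineXY : (X Y : Subspace n) → suc k < n →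
             InC t (k ∸ 1) X → InC t (suc k) Y → X ⊆ Y → PLine n k t
    lineX  : (X : Subspace n) → suc k ≡ n → InC t (n ∸ 2) X → PLine n k t

  onP : ∀ {n k t} → Subspace n → PLine n k t → Set
  onP {k = k} {t = t} Z (lineXY X Y _ _ _ _) = InC t k Z × X ⊆ Z × Z ⊆ Y
  onP {n = n} {t = t} Z (lineX X _ _)        = InC t (n ∸ 1) Z × X ⊆ Z

  Codes : ℕ → ℕ → ℕ → Geometry
  Codes n k t = record
    { Point = Σ (Subspace n) λ Z → InC t k Z
    ; _≈ₚ_  = λ P Q → Lift1 (proj₁ P ≐ proj₁ Q)
    ; Line  = PLine n k t
    ; _on_  = λ P l → Lift1 (onP (proj₁ P) l)
    }
    where
    open import Level using (Lift; lift)
    Lift1 : Set → Set₁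
    Lift1 A = Lift _ A

  InC⇒HasDim : ∀ {n t k} (Z : Subspace n) → InC t k Z → HasDim Z k
  InC⇒HasDim Z (vs , b , _) = vs , b

  ι : ∀ n k t → Geometry.Point (Codes n k t) → Geometry.Point (Grass n k)
  ι n k t (Z , c) = Z , InC⇒HasDim Z c

-- A linear relation with coefficients c among the columns js of a generator matrix of S is
-- the same thing as the linear form v ↦ Σₐ cₐ v(js a) vanishing on S.  Hence being a code is a
-- property of the subspace alone, inherited by every superspace, and ι maps lines onto lines.
-- For transparency let every k-space between X and Y (dim X = k-1, dim Y = k+1, or Y = Fⁿ when
-- k = n-1) be a code, and let such a form W vanish on X.  As Y ∩ ker W has dimension at least
-- k > dim X, the Steinitz exchange lemma gives y ∈ Y ∩ ker W outside X; then W vanishes on the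
-- code X + ⟨y⟩, so c = 0.  Thus X is a code, and so is Y ⊇ X.
-- Finiteness of F only serves to decide span membership by exhaustive search, which makes the
-- exchange argument constructive.
module Submission where

open import Defs
open import Level using (lift)
open import Data.Nat using (ℕ; zero; suc; s≤s; _<_; _≤_)
open import Data.Nat.Properties using (n<1+n)
open import Data.Fin using (Fin; zero; suc; punchIn)
open import Data.Fin.Properties using (any?; all?) renaming (_≟_ to _≟ᶠ_)
open import Data.Vec.Functional using (_∷_; removeAt; insertAt)
open import Data.Vec.Functional.Properties using (insertAt-lookup; insertAt-punchIn)
open import Data.Product using (Σ; ∃; _,_; proj₁; proj₂; _×_)
open import Data.Unit using (⊤; tt)
open import Data.Empty using (⊥-elim)
open import Relation.Nullary using (¬_; Dec; yes; no)
open import Relation.Nullary.Decidable using (¬?; decidable-stable)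
open import Relation.Binary.PropositionalEquality using (_≡_) renaming (refl to ≡-refl)
open import Function.Base using (_∘_)
open import Function.Definitions using (Injective)

module LinearAlgebra (F : FiniteField) where
  open FiniteField F hiding (zero)
  open Lin F
  open import Algebra.Properties.Ring ring using (-‿distribˡ-*; -‿distribʳ-*; -‿involutive)
  open import Algebra.Properties.AbelianGroup +-abelianGroup using (inverseʳ-unique)
  open import Algebra.Properties.CommutativeSemigroup *-commutativeSemigroup using (x∙yz≈y∙xz)
  open import Algebra.Properties.Semiring.Sum semiring
    using (sum; sum-cong-≋; sum-remove; sum-replicate-zero; ∑-distrib-+; *-distribˡ-sum; *-distribʳ-sum)
  open import Relation.Binary.Reasoning.Setoid setoid

  infix 4 _≟_
  _≟_ : (x y : Carrier) → Dec (x ≈ y)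
  x ≟ y with enum-surj x | enum-surj y
  ... | i , ei≈x | j , ej≈y with i ≟ᶠ j
  ... | yes ≡-refl = yes (trans (sym ei≈x) ej≈y)
  ... | no i≢j = no λ x≈y → i≢j (enum-inj i j (trans ei≈x (trans x≈y (sym ej≈y))))

  x*y≈0⇒x≈0 : ∀ {x y} → ¬ y ≈ 0# → x * y ≈ 0# → x ≈ 0#
  x*y≈0⇒x≈0 {x} {y} y≉0 xy≈0 = begin
    x              ≈⟨ *-identityʳ x ⟨
    x * 1#         ≈⟨ *-congˡ (proj₂ (inverse y y≉0)) ⟨
    x * (y * y⁻¹)  ≈⟨ *-assoc x y y⁻¹ ⟨
    (x * y) * y⁻¹  ≈⟨ *-congʳ xy≈0 ⟩
    0# * y⁻¹       ≈⟨ zeroˡ y⁻¹ ⟩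
    0#             ∎
    where y⁻¹ = proj₁ (inverse y y≉0)

  ∑-zero : ∀ {m} (f : Fin m → Carrier) → (∀ j → f j ≈ 0#) → sum f ≈ 0#
  ∑-zero {m} f f≈0 = trans (sum-cong-≋ f≈0) (sum-replicate-zero m)

  record LinearForm (n : ℕ) : Set where
    field
      apply      : Vec n → Carrier
      apply-cong : ∀ {u v} → u ≈ᵥ v → apply u ≈ apply v
      apply-+    : ∀ u v → apply (u +ᵥ v) ≈ apply u + apply v
      apply-·    : ∀ a v → apply (a ·ᵥ v) ≈ a * apply v
  open LinearForm public

  apply-0 : ∀ {n} (W : LinearForm n) → apply W 0ᵥ ≈ 0#
  apply-0 W = begin
    apply W 0ᵥ          ≈⟨ apply-cong W (λ _ → sym (zeroˡ 0#)) ⟩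
    apply W (0# ·ᵥ 0ᵥ)  ≈⟨ apply-· W 0# 0ᵥ ⟩
    0# * apply W 0ᵥ     ≈⟨ zeroˡ _ ⟩
    0#                  ∎

  apply-lincomb : ∀ {n m} (W : LinearForm n) (c : Vec m) (vs : Fin m → Vec n) →
                  apply W (lincomb c vs) ≈ sum (λ j → c j * apply W (vs j))
  apply-lincomb {m = zero}  W c vs = apply-0 W
  apply-lincomb {m = suc m} W c vs = begin
    apply W ((c zero ·ᵥ vs zero) +ᵥ lincomb (c ∘ suc) (vs ∘ suc))
      ≈⟨ apply-+ W _ _ ⟩
    apply W (c zero ·ᵥ vs zero) + apply W (lincomb (c ∘ suc) (vs ∘ suc))
      ≈⟨ +-cong (apply-· W _ _) (apply-lincomb W (c ∘ suc) (vs ∘ suc)) ⟩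
    c zero * apply W (vs zero) + sum (λ j → c (suc j) * apply W (vs (suc j))) ∎

  coordinate : ∀ {n} → Fin n → LinearForm n
  coordinate k = record
    { apply = λ v → v k ; apply-cong = λ u≈v → u≈v k ; apply-+ = λ _ _ → refl ; apply-· = λ _ _ → refl }

  lincomb-at : ∀ {n m} (c : Vec m) (vs : Fin m → Vec n) k →
               lincomb c vs k ≈ sum (λ j → c j * vs j k)
  lincomb-at c vs k = apply-lincomb (coordinate k) c vs

  lincomb-cong : ∀ {n m} {c c' : Vec m} (vs : Fin m → Vec n) → c ≈ᵥ c' → lincomb c vs ≈ᵥ lincomb c' vs
  lincomb-cong {c = c} {c'} vs c≈c' k = begin
    lincomb c vs k               ≈⟨ lincomb-at c vs k ⟩
    sum (λ j → c j * vs j k)     ≈⟨ sum-cong-≋ (λ j → *-congʳ (c≈c' j)) ⟩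
    sum (λ j → c' j * vs j k)    ≈⟨ lincomb-at c' vs k ⟨
    lincomb c' vs k              ∎

  lincomb-zero : ∀ {n m} (vs : Fin m → Vec n) → lincomb 0ᵥ vs ≈ᵥ 0ᵥ
  lincomb-zero vs k = trans (lincomb-at 0ᵥ vs k) (∑-zero _ (λ j → zeroˡ (vs j k)))

  lincomb-+ : ∀ {n m} (c c' : Vec m) (vs : Fin m → Vec n) →
              lincomb (c +ᵥ c') vs ≈ᵥ (lincomb c vs +ᵥ lincomb c' vs)
  lincomb-+ c c' vs k = begin
    lincomb (c +ᵥ c') vs k                                ≈⟨ lincomb-at (c +ᵥ c') vs k ⟩
    sum (λ j → (c j + c' j) * vs j k)                     ≈⟨ sum-cong-≋ (λ j → distribʳ (vs j k) (c j) (c' j)) ⟩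
    sum (λ j → c j * vs j k + c' j * vs j k)              ≈⟨ ∑-distrib-+ (λ j → c j * vs j k) (λ j → c' j * vs j k) ⟩
    sum (λ j → c j * vs j k) + sum (λ j → c' j * vs j k)  ≈⟨ +-cong (lincomb-at c vs k) (lincomb-at c' vs k) ⟨
    lincomb c vs k + lincomb c' vs k                      ∎

  lincomb-· : ∀ {n m} a (c : Vec m) (vs : Fin m → Vec n) → lincomb (a ·ᵥ c) vs ≈ᵥ (a ·ᵥ lincomb c vs)
  lincomb-· a c vs k = begin
    lincomb (a ·ᵥ c) vs k           ≈⟨ lincomb-at (a ·ᵥ c) vs k ⟩
    sum (λ j → (a * c j) * vs j k)  ≈⟨ sum-cong-≋ (λ j → *-assoc a (c j) (vs j k)) ⟩
    sum (λ j → a * (c j * vs j k))  ≈⟨ *-distribˡ-sum a (λ j → c j * vs j k) ⟨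
    a * sum (λ j → c j * vs j k)    ≈⟨ *-congˡ (lincomb-at c vs k) ⟨
    a * lincomb c vs k              ∎

  lincomb-removeAt : ∀ {n m} (i : Fin (suc m)) (c : Vec (suc m)) (vs : Fin (suc m) → Vec n) →
                     lincomb c vs ≈ᵥ ((c i ·ᵥ vs i) +ᵥ lincomb (removeAt c i) (removeAt vs i))
  lincomb-removeAt i c vs k = begin
    lincomb c vs k                                                 ≈⟨ lincomb-at c vs k ⟩
    sum (λ j → c j * vs j k)                                       ≈⟨ sum-remove (λ j → c j * vs j k) ⟩
    c i * vs i k + sum (λ j → removeAt c i j * removeAt vs i j k)  ≈⟨ +-congˡ (lincomb-at (removeAt c i) (removeAt vs i) k) ⟨
    c i * vs i k + lincomb (removeAt c i) (removeAt vs i) k        ∎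

  ∈-lincomb : ∀ {n m} (S : Subspace n) (c : Vec m) (vs : Fin m → Vec n) →
              (∀ j → mem S (vs j)) → mem S (lincomb c vs)
  ∈-lincomb {m = zero}  S c vs vs∈S = mem-0 S
  ∈-lincomb {m = suc m} S c vs vs∈S =
    mem-+ S (mem-· S (c zero) (vs∈S zero)) (∈-lincomb S (c ∘ suc) (vs ∘ suc) (vs∈S ∘ suc))

  unit : ∀ {m} → Fin m → Vec m
  unit {suc m} i = insertAt 0ᵥ i 1#

  ∑-unit : ∀ {m} (i : Fin m) (f : Fin m → Carrier) → sum (λ j → unit i j * f j) ≈ f i
  ∑-unit {suc m} i f = begin
    sum (λ j → unit i j * f j)                                      ≈⟨ sum-remove (λ j → unit i j * f j) ⟩
    unit i i * f i + sum (λ j → unit i (punchIn i j) * f (punchIn i j))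
      ≈⟨ +-cong (*-congʳ (reflexive (insertAt-lookup 0ᵥ i 1#)))
                (∑-zero _ (λ j → trans (*-congʳ (reflexive (insertAt-punchIn 0ᵥ i 1# j))) (zeroˡ _))) ⟩
    1# * f i + 0#                                                   ≈⟨ +-identityʳ _ ⟩
    1# * f i                                                        ≈⟨ *-identityˡ (f i) ⟩
    f i                                                             ∎

  lincomb-unit : ∀ {n m} (i : Fin m) (vs : Fin m → Vec n) → lincomb (unit i) vs ≈ᵥ vs i
  lincomb-unit i vs k = trans (lincomb-at (unit i) vs k) (∑-unit i (λ j → vs j k))

  standardBasis : ∀ {n} → Fin n → Vec n
  standardBasis j k = unit k j

  standardBasis-LinIndep : ∀ {n} → LinIndep (standardBasis {n})
  standardBasis-LinIndep c comb≈0 k = begin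
    c k                           ≈⟨ ∑-unit k c ⟨
    sum (λ j → unit k j * c j)    ≈⟨ sum-cong-≋ (λ j → *-comm (unit k j) (c j)) ⟩
    sum (λ j → c j * unit k j)    ≈⟨ lincomb-at c standardBasis k ⟨
    lincomb c standardBasis k     ≈⟨ comb≈0 k ⟩
    0#                            ∎

  InSpan : ∀ {n m} → (Fin m → Vec n) → Vec n → Set
  InSpan {m = m} xs v = Σ (Vec m) λ c → lincomb c xs ≈ᵥ v

  span : ∀ {n m} → (Fin m → Vec n) → Subspace n
  span xs = record
    { mem   = InSpan xs
    ; resp  = λ { u≈v (c , comb≈u) → c , λ k → trans (comb≈u k) (u≈v k) }
    ; mem-0 = 0ᵥ , lincomb-zero xs
    ; mem-+ = λ { (c , comb≈u) (c' , comb≈v) →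
                  c +ᵥ c' , λ k → trans (lincomb-+ c c' xs k) (+-cong (comb≈u k) (comb≈v k)) }
    ; mem-· = λ { a (c , comb≈v) → a ·ᵥ c , λ k → trans (lincomb-· a c xs k) (*-congˡ (comb≈v k)) }
    }

  span-⊆ : ∀ {n m} (S : Subspace n) (xs : Fin m → Vec n) → (∀ i → mem S (xs i)) → span xs ⊆ S
  span-⊆ S xs xs∈S v (c , comb≈v) = resp S comb≈v (∈-lincomb S c xs xs∈S)

  span-IsBasis : ∀ {n m} (xs : Fin m → Vec n) → LinIndep xs → IsBasis (span xs) xs
  span-IsBasis xs indep = (λ i → unit i , lincomb-unit i xs) , indep , (λ v v∈span → v∈span)

  any-vector? : ∀ m (P : Vec m → Set) → (∀ {c c'} → c ≈ᵥ c' → P c → P c') →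
                (∀ c → Dec (P c)) → Dec (∃ P)
  any-vector? zero P resp P? with P? (λ ())
  ... | yes p = yes (_ , p)
  ... | no ¬p = no λ (c , pc) → ¬p (resp (λ ()) pc)
  any-vector? (suc m) P resp P? with any? (λ i →
      any-vector? m (λ c → P (enum i ∷ c)) (λ c≈c' → resp λ { zero → refl ; (suc j) → c≈c' j })
                    (λ c → P? (enum i ∷ c)))
  ... | yes (i , c , p) = yes (enum i ∷ c , p)
  ... | no none = no λ (c , pc) →
      let (i , ei≈c₀) = enum-surj (c zero)
      in none (i , c ∘ suc , resp (λ { zero → sym ei≈c₀ ; (suc j) → refl }) pc)

  inSpan? : ∀ {n m} (xs : Fin m → Vec n) v → Dec (InSpan xs v)
  inSpan? {m = m} xs v = any-vector? m (λ c → lincomb c xs ≈ᵥ v)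
    (λ c≈c' comb≈v k → trans (sym (lincomb-cong xs c≈c' k)) (comb≈v k))
    (λ c → all? (λ k → lincomb c xs k ≟ v k))

  zero-head⇒¬LinIndep : ∀ {n p} (vs : Fin (suc p) → Vec n) → vs zero ≈ᵥ 0ᵥ → ¬ LinIndep vs
  zero-head⇒¬LinIndep vs vs₀≈0 indep = nontrivial (indep (1# ∷ 0ᵥ) comb≈0 zero)
    where
    comb≈0 : lincomb (1# ∷ 0ᵥ) vs ≈ᵥ 0ᵥ
    comb≈0 k = begin
      1# * vs zero k + lincomb 0ᵥ (vs ∘ suc) k  ≈⟨ +-cong (*-congˡ (vs₀≈0 k)) (lincomb-zero (vs ∘ suc) k) ⟩
      1# * 0# + 0#                              ≈⟨ +-identityʳ _ ⟩
      1# * 0#                                   ≈⟨ zeroʳ 1# ⟩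
      0#                                        ∎

  LinIndep-tail : ∀ {n p} (vs : Fin (suc p) → Vec n) → LinIndep vs → LinIndep (vs ∘ suc)
  LinIndep-tail vs indep c comb≈0 j = indep (0# ∷ c) comb'≈0 (suc j)
    where
    comb'≈0 : lincomb (0# ∷ c) vs ≈ᵥ 0ᵥ
    comb'≈0 k = trans (+-cong (zeroˡ (vs zero k)) (comb≈0 k)) (+-identityʳ 0#)

  ∷-LinIndep : ∀ {n m} (y : Vec n) (xs : Fin m → Vec n) → LinIndep xs → ¬ InSpan xs y → LinIndep (y ∷ xs)
  ∷-LinIndep y xs indep y∉span c comb≈0 with c zero ≟ 0#
  ... | no c₀≉0 = ⊥-elim (y∉span ((- c₀⁻¹) ·ᵥ (c ∘ suc) , y≈comb))
    where
    c₀⁻¹ = proj₁ (inverse (c zero) c₀≉0)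
    L = lincomb (c ∘ suc) xs
    y≈comb : lincomb ((- c₀⁻¹) ·ᵥ (c ∘ suc)) xs ≈ᵥ y
    y≈comb k = begin
      lincomb ((- c₀⁻¹) ·ᵥ (c ∘ suc)) xs k  ≈⟨ lincomb-· (- c₀⁻¹) (c ∘ suc) xs k ⟩
      - c₀⁻¹ * L k                          ≈⟨ *-congˡ (inverseʳ-unique (c zero * y k) (L k) (comb≈0 k)) ⟩
      - c₀⁻¹ * - (c zero * y k)             ≈⟨ -‿distribˡ-* c₀⁻¹ _ ⟨
      - (c₀⁻¹ * - (c zero * y k))           ≈⟨ -‿cong (-‿distribʳ-* c₀⁻¹ _) ⟨
      - - (c₀⁻¹ * (c zero * y k))           ≈⟨ -‿involutive _ ⟩
      c₀⁻¹ * (c zero * y k)                 ≈⟨ *-assoc c₀⁻¹ (c zero) (y k) ⟨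
      (c₀⁻¹ * c zero) * y k                 ≈⟨ *-congʳ (trans (*-comm c₀⁻¹ (c zero)) (proj₂ (inverse (c zero) c₀≉0))) ⟩
      1# * y k                              ≈⟨ *-identityˡ (y k) ⟩
      y k                                   ∎
  ... | yes c₀≈0 = λ where
      zero    → c₀≈0
      (suc j) → indep (c ∘ suc) tail≈0 j
    where
    tail≈0 : lincomb (c ∘ suc) xs ≈ᵥ 0ᵥ
    tail≈0 k = begin
      lincomb (c ∘ suc) xs k                   ≈⟨ +-identityˡ _ ⟨
      0# + lincomb (c ∘ suc) xs k              ≈⟨ +-congʳ (trans (*-congʳ c₀≈0) (zeroˡ (y k))) ⟨
      c zero * y k + lincomb (c ∘ suc) xs k    ≈⟨ comb≈0 k ⟩
      0#                                       ∎

  -- One step of Gaussian elimination with pivot j₀.  For w = W ∘ vs the results lie in ker W;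
  -- for w a coordinate of coefficient vectors it removes one spanning vector (exchange).
  eliminate : ∀ {n p} → (Fin (suc p) → Carrier) → Fin (suc p) → (Fin (suc p) → Vec n) → Fin p → Vec n
  eliminate w j₀ vs j = (w j₀ ·ᵥ vs (punchIn j₀ j)) +ᵥ ((- w (punchIn j₀ j)) ·ᵥ vs j₀)

  eliminate-kernel : ∀ {n p} (W : LinearForm n) (j₀ : Fin (suc p)) (vs : Fin (suc p) → Vec n) j →
                     apply W (eliminate (apply W ∘ vs) j₀ vs j) ≈ 0#
  eliminate-kernel W j₀ vs j = begin
    apply W (eliminate (apply W ∘ vs) j₀ vs j)  ≈⟨ apply-+ W _ _ ⟩
    apply W (e ·ᵥ vs (punchIn j₀ j)) + apply W ((- x) ·ᵥ vs j₀)
      ≈⟨ +-cong (apply-· W _ _) (apply-· W _ _) ⟩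
    e * x + - x * e                             ≈⟨ +-congˡ (-‿distribˡ-* x e) ⟨
    e * x + - (x * e)                           ≈⟨ +-congˡ (-‿cong (*-comm x e)) ⟩
    e * x + - (e * x)                           ≈⟨ -‿inverseʳ (e * x) ⟩
    0#                                          ∎
    where
    e = apply W (vs j₀)
    x = apply W (vs (punchIn j₀ j))

  eliminate-∈ : ∀ {n p} (S : Subspace n) w (j₀ : Fin (suc p)) (vs : Fin (suc p) → Vec n) →
                (∀ i → mem S (vs i)) → ∀ j → mem S (eliminate w j₀ vs j)
  eliminate-∈ S w j₀ vs vs∈S j = mem-+ S (mem-· S _ (vs∈S (punchIn j₀ j))) (mem-· S _ (vs∈S j₀))

  eliminate-lincomb : ∀ {n m p} w (j₀ : Fin (suc p)) (as : Fin (suc p) → Vec m) (xs : Fin m → Vec n) j →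
                      lincomb (eliminate w j₀ as j) xs ≈ᵥ eliminate w j₀ (λ i → lincomb (as i) xs) j
  eliminate-lincomb w j₀ as xs j k =
    trans (lincomb-+ _ _ xs k) (+-cong (lincomb-· _ (as (punchIn j₀ j)) xs k) (lincomb-· _ (as j₀) xs k))

  eliminate-LinIndep : ∀ {n p} w (j₀ : Fin (suc p)) (vs : Fin (suc p) → Vec n) →
                       ¬ w j₀ ≈ 0# → LinIndep vs → LinIndep (eliminate w j₀ vs)
  eliminate-LinIndep {p = p} w j₀ vs e≉0 indep c comb≈0 j =
    x*y≈0⇒x≈0 e≉0 (trans (sym (reflexive (insertAt-punchIn ce j₀ s j))) (indep d d-comb≈0 (punchIn j₀ j)))
    where
    e = w j₀
    ce : Vec p
    ce j = c j * e
    s = sum (λ j → c j * - w (punchIn j₀ j))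
    -- the coefficients of Σⱼ cⱼ uⱼ with respect to vs
    d = insertAt ce j₀ s
    factorˡ : ∀ a x y z u → (a * x) * y + (a * z) * u ≈ a * (x * y + z * u)
    factorˡ a x y z u = trans (+-cong (*-assoc a x y) (*-assoc a z u)) (sym (distribˡ a (x * y) (z * u)))
    d-comb≈0 : lincomb d vs ≈ᵥ 0ᵥ
    d-comb≈0 k = begin
      lincomb d vs k                                               ≈⟨ lincomb-removeAt j₀ d vs k ⟩
      d j₀ * vs j₀ k + lincomb (removeAt d j₀) (removeAt vs j₀) k
        ≈⟨ +-cong (*-congʳ (reflexive (insertAt-lookup ce j₀ s)))
                  (lincomb-cong (removeAt vs j₀) (λ j → reflexive (insertAt-punchIn ce j₀ s j)) k) ⟩
      s * vs j₀ k + lincomb ce (removeAt vs j₀) k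
        ≈⟨ +-cong (*-distribʳ-sum (vs j₀ k) (λ j → c j * - w (punchIn j₀ j))) (lincomb-at ce (removeAt vs j₀) k) ⟩
      sum (λ j → (c j * - w (punchIn j₀ j)) * vs j₀ k) + sum (λ j → ce j * vs (punchIn j₀ j) k)
        ≈⟨ +-comm _ _ ⟩
      sum (λ j → ce j * vs (punchIn j₀ j) k) + sum (λ j → (c j * - w (punchIn j₀ j)) * vs j₀ k)
        ≈⟨ ∑-distrib-+ (λ j → ce j * vs (punchIn j₀ j) k) (λ j → (c j * - w (punchIn j₀ j)) * vs j₀ k) ⟨
      sum (λ j → ce j * vs (punchIn j₀ j) k + (c j * - w (punchIn j₀ j)) * vs j₀ k)
        ≈⟨ sum-cong-≋ (λ j → factorˡ (c j) e _ _ _) ⟩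
      sum (λ j → c j * eliminate w j₀ vs j k)                      ≈⟨ lincomb-at c (eliminate w j₀ vs) k ⟨
      lincomb c (eliminate w j₀ vs) k                              ≈⟨ comb≈0 k ⟩
      0#                                                           ∎

  lincomb-removeAt-≈0 : ∀ {n m} (l : Fin (suc m)) (c : Vec (suc m)) (xs : Fin (suc m) → Vec n) →
                        c l ≈ 0# → lincomb c xs ≈ᵥ lincomb (removeAt c l) (removeAt xs l)
  lincomb-removeAt-≈0 l c xs cₗ≈0 k = begin
    lincomb c xs k                                           ≈⟨ lincomb-removeAt l c xs k ⟩
    c l * xs l k + lincomb (removeAt c l) (removeAt xs l) k  ≈⟨ +-congʳ (trans (*-congʳ cₗ≈0) (zeroˡ (xs l k))) ⟩
    0# + lincomb (removeAt c l) (removeAt xs l) k            ≈⟨ +-identityˡ _ ⟩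
    lincomb (removeAt c l) (removeAt xs l) k                 ∎

  exchange : ∀ {n m p} (vs : Fin (suc p) → Vec n) (xs : Fin (suc m) → Vec n) (as : Fin (suc p) → Vec (suc m)) →
             (∀ i → lincomb (as i) xs ≈ᵥ vs i) → (l₀ : Fin (suc m)) → ¬ as zero l₀ ≈ 0# →
             let us = eliminate (λ i → as i l₀) zero vs in
             (∀ j → InSpan (removeAt xs l₀) (us j)) × (LinIndep vs → LinIndep us)
  exchange vs xs as vs≈ l₀ a≉0 = us∈span , eliminate-LinIndep w zero vs a≉0
    where
    w = λ i → as i l₀
    us∈span : ∀ j → InSpan (removeAt xs l₀) (eliminate w zero vs j)
    us∈span j = removeAt c l₀ , λ k → begin
      lincomb (removeAt c l₀) (removeAt xs l₀) k      ≈⟨ lincomb-removeAt-≈0 l₀ c xs (eliminate-kernel (coordinate l₀) zero as j) k ⟨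
      lincomb c xs k                                  ≈⟨ eliminate-lincomb w zero as xs j k ⟩
      eliminate w zero (λ i → lincomb (as i) xs) j k  ≈⟨ +-cong (*-congˡ (vs≈ (suc j) k)) (*-congˡ (vs≈ zero k)) ⟩
      eliminate w zero vs j k                         ∎
      where c = eliminate w zero as j

  steinitz : ∀ {n m p} → m < p → (vs : Fin p → Vec n) (xs : Fin m → Vec n) →
             (∀ i → InSpan xs (vs i)) → ¬ LinIndep vs
  steinitz {m = zero} {suc p} _ vs xs vs∈span =
    zero-head⇒¬LinIndep vs (λ k → sym (proj₂ (vs∈span zero) k))
  steinitz {m = suc m} {suc p} (s≤s m<p) vs xs vs∈span indep
    with any? (λ l → ¬? (proj₁ (vs∈span zero) l ≟ 0#))
  ... | yes (l₀ , a≉0) =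
    let (us∈span , preserves) = exchange vs xs (proj₁ ∘ vs∈span) (proj₂ ∘ vs∈span) l₀ a≉0
    in steinitz m<p _ (removeAt xs l₀) us∈span (preserves indep)
  ... | no none = zero-head⇒¬LinIndep vs vs₀≈0 indep
    where
    vs₀≈0 : vs zero ≈ᵥ 0ᵥ
    vs₀≈0 k = begin
      vs zero k                            ≈⟨ proj₂ (vs∈span zero) k ⟨
      lincomb (proj₁ (vs∈span zero)) xs k
        ≈⟨ lincomb-cong xs (λ l → decidable-stable (_ ≟ 0#) (λ a≉0 → none (l , a≉0))) k ⟩
      lincomb 0ᵥ xs k                      ≈⟨ lincomb-zero xs k ⟩
      0#                                   ∎

  ∃-∉-span : ∀ {n m p} → m < p → (vs : Fin p → Vec n) → LinIndep vs → (xs : Fin m → Vec n) →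
             ∃ λ j → ¬ InSpan xs (vs j)
  ∃-∉-span m<p vs indep xs with any? (λ j → ¬? (inSpan? xs (vs j)))
  ... | yes found = found
  ... | no none = ⊥-elim (steinitz m<p vs xs
                    (λ j → decidable-stable (inSpan? xs (vs j)) (λ ∉ → none (j , ∉))) indep)

  independent-kernel-vectors : ∀ {n p} (S : Subspace n) (W : LinearForm n) (ys : Fin (suc p) → Vec n) →
                               (∀ i → mem S (ys i)) → LinIndep ys →
                               Σ (Fin p → Vec n) λ us → (∀ j → mem S (us j)) × (∀ j → apply W (us j) ≈ 0#) × LinIndep us
  independent-kernel-vectors S W ys ys∈S indep with any? (λ i → ¬? (apply W (ys i) ≟ 0#))
  ... | yes (i₀ , Wy≉0) =
    eliminate (apply W ∘ ys) i₀ ys , eliminate-∈ S (apply W ∘ ys) i₀ ys ys∈S ,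
    eliminate-kernel W i₀ ys , eliminate-LinIndep (apply W ∘ ys) i₀ ys Wy≉0 indep
  ... | no none =
    ys ∘ suc , ys∈S ∘ suc ,
    (λ j → decidable-stable (_ ≟ 0#) (λ Wy≉0 → none (suc j , Wy≉0))) , LinIndep-tail ys indep

  ∃-kernel-vector-∉-span : ∀ {n m} (S : Subspace n) (W : LinearForm n) (ys : Fin (suc (suc m)) → Vec n) →
                           (∀ i → mem S (ys i)) → LinIndep ys → (xs : Fin m → Vec n) →
                           Σ (Vec n) λ y → mem S y × apply W y ≈ 0# × ¬ InSpan xs y
  ∃-kernel-vector-∉-span {m = m} S W ys ys∈S indep xs =
    let (us , us∈S , Wus≈0 , us-indep) = independent-kernel-vectors S W ys ys∈S indep
        (j , uⱼ∉span) = ∃-∉-span (n<1+n m) us us-indep xs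
    in us j , us∈S j , Wus≈0 j , uⱼ∉span

  InSpan-∷ : ∀ {n m} (y : Vec n) (xs : Fin m → Vec n) {v} → InSpan xs v → InSpan (y ∷ xs) v
  InSpan-∷ y xs (c , comb≈v) = 0# ∷ c , λ k → trans (+-congʳ (zeroˡ (y k))) (trans (+-identityˡ _) (comb≈v k))

  vanish-on-span : ∀ {n m} (W : LinearForm n) (xs : Fin m → Vec n) →
                   (∀ j → apply W (xs j) ≈ 0#) → ∀ v → InSpan xs v → apply W v ≈ 0#
  vanish-on-span W xs Wxs≈0 v (c , comb≈v) = begin
    apply W v                               ≈⟨ apply-cong W comb≈v ⟨
    apply W (lincomb c xs)                  ≈⟨ apply-lincomb W c xs ⟩
    sum (λ j → c j * apply W (xs j))        ≈⟨ ∑-zero _ (λ j → trans (*-congˡ (Wxs≈0 j)) (zeroʳ (c j))) ⟩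
    0#                                      ∎

  columnForm : ∀ {n t} → (Fin t → Fin n) → Vec t → LinearForm n
  columnForm js c = record
    { apply      = λ v → sum (λ a → c a * v (js a))
    ; apply-cong = λ u≈v → sum-cong-≋ (λ a → *-congˡ (u≈v (js a)))
    ; apply-+    = λ u v → trans (sum-cong-≋ (λ a → distribˡ (c a) (u (js a)) (v (js a))))
                                 (∑-distrib-+ (λ a → c a * u (js a)) (λ a → c a * v (js a)))
    ; apply-·    = λ b v → trans (sum-cong-≋ (λ a → x∙yz≈y∙xz (c a) b (v (js a))))
                                 (sym (*-distribˡ-sum b (λ a → c a * v (js a))))
    }

  -- basis-free form of AnyColsIndep
  ColumnsIndependent : ∀ {n} → ℕ → Subspace n → Set
  ColumnsIndependent {n} t S =
    ∀ (js : Fin t → Fin n) → Injective _≡_ _≡_ js → ∀ c →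
    (∀ v → mem S v → apply (columnForm js c) v ≈ 0#) → ∀ a → c a ≈ 0#

  ColumnsIndependent-⊆ : ∀ {n t} {X Z : Subspace n} → X ⊆ Z → ColumnsIndependent t X → ColumnsIndependent t Z
  ColumnsIndependent-⊆ X⊆Z indep js js-inj c W≈0 = indep js js-inj c (λ v v∈X → W≈0 v (X⊆Z v v∈X))

  InC⇒ColumnsIndependent : ∀ {n t m} {S : Subspace n} → InC t m S → ColumnsIndependent t S
  InC⇒ColumnsIndependent (vs , (vs∈S , _) , cols-indep) js js-inj c W≈0 =
    cols-indep js js-inj c (λ i → trans (lincomb-at c _ i) (W≈0 (vs i) (vs∈S i)))

  ColumnsIndependent⇒InC : ∀ {n t m} {S : Subspace n} → HasDim S m → ColumnsIndependent t S → InC t m S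
  ColumnsIndependent⇒InC (vs , basis@(_ , _ , spanning)) indep = vs , basis , λ js js-inj c rel≈0 →
    indep js js-inj c λ v v∈S →
      vanish-on-span (columnForm js c) vs (λ i → trans (sym (lincomb-at c _ i)) (rel≈0 i)) v (spanning v v∈S)

  InC-⊆ : ∀ {n t m m'} (X Z : Subspace n) → InC t m' X → X ⊆ Z → HasDim Z m → InC t m Z
  InC-⊆ X Z X∈C X⊆Z Z-dim =
    ColumnsIndependent⇒InC {S = Z} Z-dim (ColumnsIndependent-⊆ {X = X} {Z} X⊆Z (InC⇒ColumnsIndependent {S = X} X∈C))

  ColumnsIndependent-of-pencil :
    ∀ {n m t} (X Y : Subspace n) → HasDim X m → X ⊆ Y →
    (ys : Fin (suc (suc m)) → Vec n) → (∀ i → mem Y (ys i)) → LinIndep ys →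
    (∀ Z → HasDim Z (suc m) → X ⊆ Z → Z ⊆ Y → ColumnsIndependent t Z) → ColumnsIndependent t X
  ColumnsIndependent-of-pencil X Y (xs , xs∈X , xs-indep , xs-span) X⊆Y ys ys∈Y ys-indep between js js-inj c W≈0
    with ∃-kernel-vector-∉-span Y (columnForm js c) ys ys∈Y ys-indep xs
  ... | y , y∈Y , Wy≈0 , y∉span = between (span zs) Z-dim X⊆Z Z⊆Y js js-inj c W≈0-on-Z
    where
    zs = y ∷ xs
    Z-dim : HasDim (span zs) _
    Z-dim = zs , span-IsBasis zs (∷-LinIndep y xs xs-indep y∉span)
    X⊆Z : X ⊆ span zs
    X⊆Z v v∈X = InSpan-∷ y xs (xs-span v v∈X)
    Z⊆Y : span zs ⊆ Y
    Z⊆Y = span-⊆ Y zs λ { zero → y∈Y ; (suc i) → X⊆Y _ (xs∈X i) }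
    W≈0-on-Z : ∀ v → InSpan zs v → apply (columnForm js c) v ≈ 0#
    W≈0-on-Z = vanish-on-span (columnForm js c) zs λ { zero → Wy≈0 ; (suc i) → W≈0 (xs i) (xs∈X i) }

  fullSpace : ∀ n → Subspace n
  fullSpace n = record { mem = λ _ → ⊤ ; resp = λ _ _ → tt ; mem-0 = tt ; mem-+ = λ _ _ → tt ; mem-· = λ _ _ → tt }

  ⊆-refl : ∀ {n} {X : Subspace n} → X ⊆ X
  ⊆-refl v v∈X = v∈X

  ⊆-trans : ∀ {n} {X Y Z : Subspace n} → X ⊆ Y → Y ⊆ Z → X ⊆ Z
  ⊆-trans X⊆Y Y⊆Z v v∈X = Y⊆Z v (X⊆Y v v∈X)

module Geometries (F : FiniteField) where
  open Lin F
  open LinearAlgebra F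
  open Geometry using (Point; _on_; _≈ₚ_)

  ι-isEmbedding : ∀ n k t → IsEmbedding (Codes n k t) (Grass n k) (ι n k t)
  ι-isEmbedding n k t = record { injective = λ _ _ P≐Q → P≐Q ; image-line = image-line }
    where
    image-line : ∀ (l : PLine n k t) → Σ (GLine n k) λ l' → ∀ (x : Point (Grass n k)) →
                 _on_ (Grass n k) x l' ⇔ (Σ (Point (Codes n k t)) λ p → _on_ (Codes n k t) p l × _≈ₚ_ (Grass n k) (ι n k t p) x)
    image-line (lineXY X Y lt X∈C Y∈C X⊆Y) =
      lineXY X Y lt (InC⇒HasDim X X∈C) (InC⇒HasDim Y Y∈C) X⊆Y , λ (Z , Z-dim) →
        (λ (lift (_ , X⊆Z , Z⊆Y)) →
           let Z∈C = InC-⊆ X Z X∈C X⊆Z Z-dim in (Z , Z∈C) , lift (Z∈C , X⊆Z , Z⊆Y) , lift (⊆-refl {X = Z} , ⊆-refl {X = Z})) ,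
        (λ ((P , _) , lift (_ , X⊆P , P⊆Y) , lift (P⊆Z , Z⊆P)) →
           lift (Z-dim , ⊆-trans {X = X} {P} {Z} X⊆P P⊆Z , ⊆-trans {X = Z} {P} {Y} Z⊆P P⊆Y))
    image-line (lineX X ≡-refl X∈C) =
      lineX X ≡-refl (InC⇒HasDim X X∈C) , λ (Z , Z-dim) →
        (λ (lift (_ , X⊆Z)) →
           let Z∈C = InC-⊆ X Z X∈C X⊆Z Z-dim in (Z , Z∈C) , lift (Z∈C , X⊆Z) , lift (⊆-refl {X = Z} , ⊆-refl {X = Z})) ,
        (λ ((P , _) , lift (_ , X⊆P) , lift (P⊆Z , _)) → lift (Z-dim , ⊆-trans {X = X} {P} {Z} X⊆P P⊆Z))

  image⇒ColumnsIndependent : ∀ {n k t} (x : Point (Grass n k)) →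
                             Σ (Point (Codes n k t)) (λ p → _≈ₚ_ (Grass n k) (ι n k t p) x) →
                             ColumnsIndependent t (proj₁ x)
  image⇒ColumnsIndependent (Z , _) ((P , P∈C) , lift (P⊆Z , _)) =
    ColumnsIndependent-⊆ {X = P} {Z} P⊆Z (InC⇒ColumnsIndependent {S = P} P∈C)

  ι-transparent : ∀ n k t → 0 < k → (l' : GLine n k) →
    (∀ (x : Point (Grass n k)) → _on_ (Grass n k) x l' → Σ (Point (Codes n k t)) λ p → _≈ₚ_ (Grass n k) (ι n k t p) x) →
    Σ (PLine n k t) λ l → ∀ (p : Point (Codes n k t)) → _on_ (Codes n k t) p l ⇔ _on_ (Grass n k) (ι n k t p) l'
  ι-transparent n zero t () l' covered
  ι-transparent n (suc m) t _ (lineXY X Y lt X-dim Y-dim@(ys , ys∈Y , ys-indep , _) X⊆Y) covered =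
    lineXY X Y lt X∈C (InC-⊆ X Y X∈C X⊆Y Y-dim) X⊆Y ,
    λ (Z , Z∈C) → (λ (lift (_ , X⊆Z , Z⊆Y)) → lift (InC⇒HasDim Z Z∈C , X⊆Z , Z⊆Y)) ,
                  (λ (lift (_ , X⊆Z , Z⊆Y)) → lift (Z∈C , X⊆Z , Z⊆Y))
    where
    X∈C : InC t m X
    X∈C = ColumnsIndependent⇒InC {S = X} X-dim
      (ColumnsIndependent-of-pencil X Y X-dim X⊆Y ys ys∈Y ys-indep λ Z Z-dim X⊆Z Z⊆Y →
         image⇒ColumnsIndependent (Z , Z-dim) (covered (Z , Z-dim) (lift (Z-dim , X⊆Z , Z⊆Y))))
  ι-transparent .(suc (suc m)) (suc m) t _ (lineX X ≡-refl X-dim) covered =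
    lineX X ≡-refl X∈C ,
    λ (Z , Z∈C) → (λ (lift (_ , X⊆Z)) → lift (InC⇒HasDim Z Z∈C , X⊆Z)) ,
                  (λ (lift (_ , X⊆Z)) → lift (Z∈C , X⊆Z))
    where
    X∈C : InC t m X
    X∈C = ColumnsIndependent⇒InC {S = X} X-dim
      (ColumnsIndependent-of-pencil X (fullSpace _) X-dim (λ _ _ → tt) standardBasis (λ _ → tt) standardBasis-LinIndep
         λ Z Z-dim X⊆Z _ → image⇒ColumnsIndependent (Z , Z-dim) (covered (Z , Z-dim) (lift (Z-dim , X⊆Z))))

theorem1p11 : (F : FiniteField) → IsPrimePower (FiniteField.size F) →
    (n k t : ℕ) → 0 < k → k < n → t ≤ k →
    IsTransparentEmbedding (Lin.Codes F n k t) (Lin.Grass F n k) (Lin.ι F n k t)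
theorem1p11 F _ n k t 0<k _ _ = record
  { embedding   = ι-isEmbedding n k t
  ; transparent = ι-transparent n k t 0<k
  }
  where open Geometries F
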